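{- Let $a,b,c$ be pairwise coprime positive integers with $\min\{a,b,c\}>1$. Let $(A,B,C,\lambda)$ be the unique element of $\{(a,b,c,1),(c,a,b,-1),(c,b,a,-1)\}$ with $C=\max\{a,b,c\}$, and consider the equation $$A^X+\lambda B^Y=C^Z,\qquad X,Y,Z\in\mathbb{N}.$$ Suppose this equation has solutions, and let $(X_1,Y_1,Z_1)$ be a solution such that $Z_1\le Z$ for every solution $(X,Y,Z)$. Let $n_1$ be the least positive integer $n$ such that $A^n\equiv\delta\pmod{C^{Z_1}}$ for some $\delta\in\{1,-1\}$, let $\delta_1\in\{1,-1\}$ satisfy $A^{n_1}\equiv\delta_1\pmod{C^{Z_1}}$, and define the positive integer $f$ by $A^{n_1}=C^{Z_1}f+\delta_1$. If the equation has a second solution $(X_2,Y_2,Z_2)$ with $Z_1<Z_2$, then $\gcd(C,f)\le Y_2$.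
   Context: $\mathbb{N}$ denotes the set of positive integers. Since $\gcd(A,C)=1$, a positive integer $n$ with $A^n\equiv\pm1\pmod{C^{Z_1}}$ exists, and $f$ is a positive integer. -}

module Defs where

open import Data.Nat using (ℕ; _≤_; _<_; _⊔_)
open import Data.Nat.Coprimality using (Coprime)
open import Data.Integer as ℤ using (ℤ; +_; _-_)
open import Data.Integer.Divisibility as ℤD using ()
open import Data.Sum using (_⊎_)
open import Data.Product using (_×_; ∃)
open import Relation.Binary.PropositionalEquality using (_≡_)

IsSign : ℤ → Set
IsSign δ = δ ≡ ℤ.1ℤ ⊎ δ ≡ ℤ.-1ℤ

IsTriple : ℕ → ℕ → ℕ → ℕ → ℕ → ℕ → ℤ → Set
IsTriple a b c A B C λ′ =
    (A ≡ a × B ≡ b × C ≡ c × λ′ ≡ ℤ.1ℤ)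
  ⊎ (A ≡ c × B ≡ a × C ≡ b × λ′ ≡ ℤ.-1ℤ)
  ⊎ (A ≡ c × B ≡ b × C ≡ a × λ′ ≡ ℤ.-1ℤ)

Solution : ℕ → ℕ → ℕ → ℤ → ℕ → ℕ → ℕ → Set
Solution A B C λ′ X Y Z =
  1 ≤ X × 1 ≤ Y × 1 ≤ Z ×
  ((+ A) ℤ.^ X ℤ.+ λ′ ℤ.* (+ B) ℤ.^ Y ≡ (+ C) ℤ.^ Z)

CongMod : ℕ → ℕ → ℕ → ℕ → ℤ → Set
CongMod A C Z n δ = ((+ C) ℤ.^ Z) ℤD.∣ ((+ A) ℤ.^ n - δ)

PlusMinusOneOrder : ℕ → ℕ → ℕ → ℕ → Set
PlusMinusOneOrder A C Z n = 1 ≤ n × ∃ λ δ → IsSign δ × CongMod A C Z n δ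

module Submission where

-- Put h = C^{Z₁}, d = gcd(C, f), N = h·d and s = -λ.  The two
-- solutions give A^{X₁} = h + s·B^{Y₁} and A^{X₂} = C^{Z₂} + s·B^{Y₂}, and N
-- divides both h² and C^{Z₂}.  Raising the first to the power Y₂ (binomial
-- theorem modulo h²) and the second to the power Y₁ (modulo C^{Z₂}) and
-- comparing the common term B^{Y₁Y₂} yields
--     A^{X₁Y₂} ≡ σ·A^{X₂Y₁} + h·Y₂·w   (mod N),   σ = ±1,  gcd(d, w) = 1.
-- Since A^{n₁} = h·f + δ₁, also A^{n₁} ≡ δ₁ (mod N); together with the
-- minimality of n₁ this shows that every congruence A^k ≡ ±1 (mod h) already
-- holds modulo N, and hence so does every congruence A^p ≡ ±A^q (mod h).
-- Reading the displayed congruence modulo h and lifting it back to N forces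
-- N ∣ h·Y₂·w, i.e. d ∣ Y₂·w, so d ∣ Y₂ and gcd(C, f) ≤ Y₂.

open import Defs
open import Level using (0ℓ)
open import Data.Nat as ℕ using (ℕ; zero; suc; _≤_; _<_; _⊔_; _∸_; z≤n; s≤s)
import Data.Nat.Properties as ℕP
open import Data.Nat.DivMod using (_%_; _/_; m≡m%n+[m/n]*n; m%n<n)
import Data.Nat.Divisibility as ℕD
open import Data.Nat.Coprimality as Cop using (Coprime; coprime-divisor)
open import Data.Nat.GCD using (gcd; gcd[m,n]∣m; gcd[m,n]∣n)
open import Data.Integer as ℤ using (ℤ; +_; _+_; _-_; _*_; -_; ∣_∣; _^_; 0ℤ; 1ℤ)
import Data.Integer.Properties as ℤP
import Data.Integer.Coprimality as ℤCop
open import Data.Integer.Divisibility.Signed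
  using (_∣_; divides; ∣ᵤ⇒∣; ∣⇒∣ᵤ; ∣-refl; ∣-trans; ∣m⇒∣-m; ∣m∣n⇒∣m+n; ∣m∣n⇒∣m-n; ∣n⇒∣m*n; ∣m⇒∣m*n; *-monoʳ-∣; *-cancelˡ-∣)
open import Data.Integer.Tactic.RingSolver using (solve-∀)
open import Data.Product using (_×_; _,_)
open import Data.Sum using (inj₁; inj₂)
open import Data.Empty using (⊥-elim)
open import Relation.Nullary using (yes; no)
open import Relation.Binary.Bundles using (Setoid)
open import Relation.Binary.Structures using (IsEquivalence)
import Relation.Binary.Reasoning.Setoid as SetoidReasoning
open import Relation.Binary.PropositionalEquality using (_≡_; _≢_; refl; sym; trans; cong; subst; subst₂)

-- Congruence of integers modulo m: m divides x - y.  (A record, so that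
-- x, y and m can be inferred from the type.)
infix 4 _≡_mod_
record _≡_mod_ (x y m : ℤ) : Set where
  constructor congruent
  field divides-difference : m ∣ x - y
open _≡_mod_ public

module _ {m : ℤ} where

  ≡⇒≡-mod : ∀ {x y} → x ≡ y → x ≡ y mod m
  ≡⇒≡-mod {x} refl = congruent (divides 0ℤ (trans (ℤP.+-inverseʳ x) (sym (ℤP.*-zeroˡ m))))

  ≡-mod-refl : ∀ x → x ≡ x mod m
  ≡-mod-refl x = ≡⇒≡-mod refl

  ≡-mod-sym : ∀ {x y} → x ≡ y mod m → y ≡ x mod m
  ≡-mod-sym {x} {y} (congruent p) = congruent (subst (m ∣_) (negated-difference x y) (∣m⇒∣-m p))
    where
    negated-difference : ∀ x y → - (x - y) ≡ y - x
    negated-difference = solve-∀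

  ≡-mod-trans : ∀ {x y z} → x ≡ y mod m → y ≡ z mod m → x ≡ z mod m
  ≡-mod-trans {x} {y} {z} (congruent p) (congruent q) = congruent (subst (m ∣_) (telescope x y z) (∣m∣n⇒∣m+n p q))
    where
    telescope : ∀ x y z → (x - y) + (y - z) ≡ x - z
    telescope = solve-∀

  +-cong-mod : ∀ {x y u v} → x ≡ y mod m → u ≡ v mod m → x + u ≡ y + v mod m
  +-cong-mod {x} {y} {u} {v} (congruent p) (congruent q) = congruent (subst (m ∣_) (regroup x y u v) (∣m∣n⇒∣m+n p q))
    where
    regroup : ∀ x y u v → (x - y) + (u - v) ≡ (x + u) - (y + v)
    regroup = solve-∀

  *-cong-mod : ∀ {x y u v} → x ≡ y mod m → u ≡ v mod m → x * u ≡ y * v mod m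
  *-cong-mod {x} {y} {u} {v} (congruent p) (congruent q) =
    congruent (subst (m ∣_) (regroup x y u v) (∣m∣n⇒∣m+n (∣n⇒∣m*n u p) (∣n⇒∣m*n y q)))
    where
    regroup : ∀ x y u v → u * (x - y) + y * (u - v) ≡ x * u - y * v
    regroup = solve-∀

  ^-cong-mod : ∀ {x y} n → x ≡ y mod m → x ^ n ≡ y ^ n mod m
  ^-cong-mod zero    p = ≡⇒≡-mod refl
  ^-cong-mod (suc n) p = *-cong-mod p (^-cong-mod n p)

  +-multiple-mod : ∀ x {k} → m ∣ k → x + k ≡ x mod m
  +-multiple-mod x {k} p = congruent (subst (m ∣_) (sym (cancel x k)) p)
    where
    cancel : ∀ x k → (x + k) - x ≡ k
    cancel = solve-∀

≡-mod-weaken : ∀ {d m x y} → d ∣ m → x ≡ y mod m → x ≡ y mod d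
≡-mod-weaken d∣m (congruent p) = congruent (∣-trans d∣m p)

≡-mod-isEquivalence : (m : ℤ) → IsEquivalence (λ x y → x ≡ y mod m)
≡-mod-isEquivalence m = record
  { refl = ≡-mod-refl _ ; sym = ≡-mod-sym ; trans = ≡-mod-trans }

≡-mod-setoid : ℤ → Setoid 0ℓ 0ℓ
≡-mod-setoid m = record { isEquivalence = ≡-mod-isEquivalence m }

module ≡-mod-Reasoning (m : ℤ) = SetoidReasoning (≡-mod-setoid m)

sign-sq : ∀ {s} → IsSign s → s * s ≡ 1ℤ
sign-sq (inj₁ refl) = refl
sign-sq (inj₂ refl) = refl

sign-* : ∀ {s t} → IsSign s → IsSign t → IsSign (s * t)
sign-* (inj₁ refl) (inj₁ refl) = inj₁ refl
sign-* (inj₁ refl) (inj₂ refl) = inj₂ refl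
sign-* (inj₂ refl) (inj₁ refl) = inj₂ refl
sign-* (inj₂ refl) (inj₂ refl) = inj₁ refl

sign-^ : ∀ {s} n → IsSign s → IsSign (s ^ n)
sign-^ zero    p = inj₁ refl
sign-^ (suc n) p = sign-* p (sign-^ n p)

sign-neg : ∀ {s} → IsSign s → IsSign (- s)
sign-neg (inj₁ refl) = inj₂ refl
sign-neg (inj₂ refl) = inj₁ refl

abs-sign-* : ∀ {s} → IsSign s → ∀ x → ∣ s * x ∣ ≡ ∣ x ∣
abs-sign-* {s} p x = trans (ℤP.abs-* s x) (trans (cong (ℕ._* ∣ x ∣) (abs-sign p)) (ℕP.*-identityˡ ∣ x ∣))
  where
  abs-sign : ∀ {s} → IsSign s → ∣ s ∣ ≡ 1
  abs-sign (inj₁ refl) = refl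
  abs-sign (inj₂ refl) = refl

-- Multiplying by a sign is an involution, so it can be moved across a congruence.
sign-transpose : ∀ {m s x y} → IsSign s → x * s ≡ y mod m → x ≡ s * y mod m
sign-transpose {m} {s} {x} {y} p q = begin
  x             ≡⟨ sym (trans (ℤP.*-assoc x s s) (trans (cong (x *_) (sign-sq p)) (ℤP.*-identityʳ x))) ⟩
  (x * s) * s   ≈⟨ *-cong-mod q (≡-mod-refl s) ⟩
  y * s         ≡⟨ ℤP.*-comm y s ⟩
  s * y         ∎
  where open ≡-mod-Reasoning m

sign-swap : ∀ {m s x y} → IsSign s → x ≡ s * y mod m → y ≡ s * x mod m
sign-swap {s = s} {x} {y} p q =
  sign-transpose p (≡-mod-trans (≡⇒≡-mod (ℤP.*-comm y s)) (≡-mod-sym q))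

sign-rigid : ∀ {m ρ σ} → IsSign ρ → IsSign σ → 2 < ∣ m ∣ → ρ ≡ σ mod m → ρ ≡ σ
sign-rigid (inj₁ refl) (inj₁ refl) _   _ = refl
sign-rigid (inj₂ refl) (inj₂ refl) _   _ = refl
sign-rigid (inj₁ refl) (inj₂ refl) m>2 (congruent p) = ⊥-elim (ℕP.<⇒≱ m>2 (ℕD.∣⇒≤ (∣⇒∣ᵤ p)))
sign-rigid (inj₂ refl) (inj₁ refl) m>2 (congruent p) = ⊥-elim (ℕP.<⇒≱ m>2 (ℕD.∣⇒≤ (∣⇒∣ᵤ p)))

coprime-* : ∀ {m n o} → Coprime m n → Coprime m o → Coprime m (n ℕ.* o)
coprime-* m⊥n m⊥o (d∣m , d∣no) =
  m⊥o (d∣m , coprime-divisor (λ (e∣d , e∣n) → m⊥n (ℕD.∣-trans e∣d d∣m , e∣n)) d∣no)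

coprime-^ : ∀ {m n} k → Coprime m n → Coprime m (n ℕ.^ k)
coprime-^ zero    m⊥n = Cop.sym (Cop.1-coprimeTo _)
coprime-^ (suc k) m⊥n = coprime-* m⊥n (coprime-^ k m⊥n)

coprime-divisorˡ : ∀ {d m n} → d ℕD.∣ m → Coprime m n → Coprime d n
coprime-divisorˡ d∣m m⊥n (e∣d , e∣n) = m⊥n (ℕD.∣-trans e∣d d∣m , e∣n)

abs-^ : ∀ x n → ∣ x ^ n ∣ ≡ ∣ x ∣ ℕ.^ n
abs-^ x zero    = refl
abs-^ x (suc n) = trans (ℤP.abs-* x (x ^ n)) (cong (∣ x ∣ ℕ.*_) (abs-^ x n))

*-cancel-mod : ∀ {m c x y} → Coprime ∣ m ∣ ∣ c ∣ → c * x ≡ c * y mod m → x ≡ y mod m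
*-cancel-mod {m} {c} {x} {y} m⊥c (congruent p) =
  congruent (∣ᵤ⇒∣ (ℤCop.coprime-divisor m c (x - y) m⊥c (∣⇒∣ᵤ (subst (m ∣_) (factor c x y) p))))
  where
  factor : ∀ c x y → c * x - c * y ≡ c * (x - y)
  factor = solve-∀

binomial-mod-sq : ∀ h u n → (h + u) ^ suc n ≡ u ^ suc n + h * (u ^ n * + suc n) mod h * h
binomial-mod-sq h u zero = ≡⇒≡-mod (base h u)
  where
  base : ∀ h u → (h + u) * 1ℤ ≡ u * 1ℤ + h * (1ℤ * 1ℤ)
  base = solve-∀
binomial-mod-sq h u (suc n) = begin
  (h + u) * (h + u) ^ suc n
    ≈⟨ *-cong-mod (≡-mod-refl (h + u)) (binomial-mod-sq h u n) ⟩
  (h + u) * (u * u ^ n + h * (u ^ n * + suc n))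
    ≡⟨ expand h u (u ^ n) (+ suc n) ⟩
  u * (u * u ^ n) + h * (u * u ^ n * (1ℤ + + suc n)) + h * h * (u ^ n * + suc n)
    ≈⟨ +-multiple-mod _ (∣m⇒∣m*n (u ^ n * + suc n) ∣-refl) ⟩
  u ^ suc (suc n) + h * (u ^ suc n * + suc (suc n))
    ∎
  where
  open ≡-mod-Reasoning (h * h)
  expand : ∀ h u U k → (h + u) * (u * U + h * (U * k))
         ≡ u * (u * U) + h * (u * U * (1ℤ + k)) + h * h * (U * k)
  expand = solve-∀

pow-reduce : ∀ {m x y} n r q → x ^ n ≡ y mod m → x ^ (r ℕ.+ q ℕ.* n) ≡ x ^ r * y ^ q mod m
pow-reduce {m} {x} {y} n r q xⁿ≡y = begin
  x ^ (r ℕ.+ q ℕ.* n)    ≡⟨ ℤP.^-distribˡ-+-* x r (q ℕ.* n) ⟩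
  x ^ r * x ^ (q ℕ.* n)  ≡⟨ cong (λ e → x ^ r * x ^ e) (ℕP.*-comm q n) ⟩
  x ^ r * x ^ (n ℕ.* q)  ≡⟨ cong (x ^ r *_) (sym (ℤP.^-*-assoc x n q)) ⟩
  x ^ r * (x ^ n) ^ q    ≈⟨ *-cong-mod (≡-mod-refl (x ^ r)) (^-cong-mod q xⁿ≡y) ⟩
  x ^ r * y ^ q          ∎
  where open ≡-mod-Reasoning m

below-order-trivial : ∀ {A C Z n₁ ρ} → (∀ n → PlusMinusOneOrder A C Z n → n₁ ≤ n) →
  IsSign ρ → ∀ r → r < n₁ → (+ A) ^ r ≡ ρ mod (+ C) ^ Z → r ≡ 0
below-order-trivial n₁-minimal ρ± zero    _     _ = refl
below-order-trivial n₁-minimal ρ± (suc r) r<n₁ (congruent p) =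
  ⊥-elim (ℕP.<⇒≱ r<n₁ (n₁-minimal (suc r) (s≤s z≤n , _ , ρ± , ∣⇒∣ᵤ p)))

-- Let n₁ be minimal as above and A^{n₁} ≡ δ₁ (mod N) for a multiple N of
-- h = C^Z with |h| > 2.  Then every congruence A^k ≡ ±1 (mod h) holds
-- modulo N: writing k = r + q·n₁ gives A^k ≡ A^r·δ₁^q (mod N), so r = 0 by
-- minimality, and δ₁^q equals the sign σ since both agree modulo h.
lift-sign-power : ∀ {A C Z n₁ δ₁ N σ} → 1 ≤ n₁ →
  (∀ n → PlusMinusOneOrder A C Z n → n₁ ≤ n) → IsSign δ₁ → IsSign σ →
  2 < ∣ (+ C) ^ Z ∣ → (+ C) ^ Z ∣ N → (+ A) ^ n₁ ≡ δ₁ mod N →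
  ∀ k → (+ A) ^ k ≡ σ mod (+ C) ^ Z → (+ A) ^ k ≡ σ mod N
lift-sign-power {A} {C} {Z} {n₁} {δ₁} {N} {σ} n₁≥1 n₁-minimal δ₁± σ± h>2 h∣N Aⁿ¹≡δ₁ k Aᵏ≡σ =
  subst (λ τ → a ^ k ≡ τ mod N) ρ≡σ Aᵏ≡ρ
  where
  a = + A
  h = (+ C) ^ Z
  instance
    _ : ℕ.NonZero n₁
    _ = ℕ.>-nonZero n₁≥1
  r = k % n₁
  q = k / n₁
  ρ = δ₁ ^ q
  ρ± : IsSign ρ
  ρ± = sign-^ q δ₁±
  reduced : a ^ k ≡ a ^ r * ρ mod N
  reduced = subst (λ e → a ^ e ≡ a ^ r * ρ mod N) (sym (m≡m%n+[m/n]*n k n₁)) (pow-reduce n₁ r q Aⁿ¹≡δ₁)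
  r≡0 : r ≡ 0
  r≡0 = below-order-trivial {C = C} {Z = Z} n₁-minimal (sign-* ρ± σ±) r (m%n<n k n₁)
          (sign-transpose ρ± (≡-mod-trans (≡-mod-sym (≡-mod-weaken h∣N reduced)) Aᵏ≡σ))
  Aᵏ≡ρ : a ^ k ≡ ρ mod N
  Aᵏ≡ρ = ≡-mod-trans (subst (λ e → a ^ k ≡ a ^ e * ρ mod N) r≡0 reduced) (≡⇒≡-mod (ℤP.*-identityˡ ρ))
  ρ≡σ : ρ ≡ σ
  ρ≡σ = sign-rigid ρ± σ± h>2 (≡-mod-trans (≡-mod-sym (≡-mod-weaken h∣N Aᵏ≡ρ)) Aᵏ≡σ)

-- If x is coprime to h and the congruences x^k ≡ σ lift from h to N, then so
-- does x^{j+k} ≡ σ·x^j: cancelling x^j gives x^k ≡ σ (mod h).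
lift-shifted : ∀ {x h N σ} → Coprime ∣ h ∣ ∣ x ∣ →
  (∀ k → x ^ k ≡ σ mod h → x ^ k ≡ σ mod N) →
  ∀ j k → x ^ (j ℕ.+ k) ≡ σ * x ^ j mod h → x ^ (j ℕ.+ k) ≡ σ * x ^ j mod N
lift-shifted {x} {h} {N} {σ} h⊥x lift j k twisted = begin
  x ^ (j ℕ.+ k)  ≡⟨ split ⟩
  x ^ j * x ^ k  ≈⟨ *-cong-mod (≡-mod-refl (x ^ j)) (lift k xᵏ≡σ) ⟩
  x ^ j * σ      ≡⟨ ℤP.*-comm (x ^ j) σ ⟩
  σ * x ^ j      ∎
  where
  open ≡-mod-Reasoning N
  split : x ^ (j ℕ.+ k) ≡ x ^ j * x ^ k
  split = ℤP.^-distribˡ-+-* x j k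
  h⊥xʲ : Coprime ∣ h ∣ ∣ x ^ j ∣
  h⊥xʲ = subst (Coprime ∣ h ∣) (sym (abs-^ x j)) (coprime-^ j h⊥x)
  xᵏ≡σ : x ^ k ≡ σ mod h
  xᵏ≡σ = *-cancel-mod {c = x ^ j} h⊥xʲ (≡-mod-trans (≡⇒≡-mod (sym split))
           (≡-mod-trans twisted (≡⇒≡-mod (ℤP.*-comm σ (x ^ j)))))

-- The same for arbitrary exponents p, q: if q ≤ p this is lift-shifted, and
-- otherwise multiplying by the sign σ exchanges the roles of p and q.
lift-twisted : ∀ {x h N σ} → Coprime ∣ h ∣ ∣ x ∣ → IsSign σ →
  (∀ k → x ^ k ≡ σ mod h → x ^ k ≡ σ mod N) →
  ∀ p q → x ^ p ≡ σ * x ^ q mod h → x ^ p ≡ σ * x ^ q mod N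
lift-twisted {x} {h} {N} {σ} h⊥x σ± lift p q with ℕP.≤-total q p
... | inj₁ q≤p = subst (λ e → x ^ e ≡ σ * x ^ q mod h → x ^ e ≡ σ * x ^ q mod N)
                   (ℕP.m+[n∸m]≡n q≤p) (lift-shifted h⊥x lift q (p ∸ q))
... | inj₂ p≤q = λ twisted → sign-swap σ±
                   (subst (λ e → x ^ e ≡ σ * x ^ p mod h → x ^ e ≡ σ * x ^ p mod N)
                     (ℕP.m+[n∸m]≡n p≤q) (lift-shifted h⊥x lift p (q ∸ p)) (sign-swap σ± twisted))

solution-shift : ∀ x λ′ y {z} → x + λ′ * y ≡ z → x ≡ z + (- λ′) * y
solution-shift x λ′ y refl = isolate x λ′ y
  where
  isolate : ∀ x l y → x ≡ (x + l * y) + (- l) * y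
  isolate = solve-∀

*-^-distrib : ∀ s x n → (s * x) ^ n ≡ s ^ n * x ^ n
*-^-distrib s x zero    = refl
*-^-distrib s x (suc n) = trans (cong ((s * x) *_) (*-^-distrib s x n)) (interchange s x (s ^ n) (x ^ n))
  where
  interchange : ∀ s x S X → s * x * (S * X) ≡ s * S * (x * X)
  interchange = solve-∀

signed-power-^ : ∀ s b Y n → (s * b ^ Y) ^ n ≡ s ^ n * b ^ (Y ℕ.* n)
signed-power-^ s b Y n = trans (*-^-distrib s (b ^ Y) n) (cong (s ^ n *_) (ℤP.^-*-assoc b Y n))

-- With s = -λ both a^{X₁Y₂} (binomial theorem
-- modulo h²) and a^{X₂Y₁} (modulo H) are congruent to ±b^{Y₁Y₂} up to the
-- term h·(s·b^{Y₁})^{y₂}·Y₂, which gives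
--   a^{X₁Y₂} ≡ s^{Y₁}s^{Y₂}·a^{X₂Y₁} + h·(s·b^{Y₁})^{y₂}·Y₂   (mod N).
two-solutions-congruence : ∀ {a b λ′ h H N} X₁ Y₁ X₂ y₂ → IsSign λ′ →
  a ^ X₁ + λ′ * b ^ Y₁ ≡ h → a ^ X₂ + λ′ * b ^ suc y₂ ≡ H → N ∣ h * h → N ∣ H →
  a ^ (X₁ ℕ.* suc y₂) ≡ ((- λ′) ^ Y₁ * (- λ′) ^ suc y₂) * a ^ (X₂ ℕ.* Y₁)
                        + h * (((- λ′) * b ^ Y₁) ^ y₂ * + suc y₂) mod N
two-solutions-congruence {a} {b} {λ′} {h} {H} {N} X₁ Y₁ X₂ y₂ λ± eq₁ eq₂ N∣h² N∣H = begin
  a ^ (X₁ ℕ.* Y₂)  ≡⟨ sym (ℤP.^-*-assoc a X₁ Y₂) ⟩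
  (a ^ X₁) ^ Y₂    ≡⟨ cong (_^ Y₂) (solution-shift (a ^ X₁) λ′ (b ^ Y₁) eq₁) ⟩
  (h + u) ^ Y₂     ≈⟨ ≡-mod-weaken N∣h² (binomial-mod-sq h u y₂) ⟩
  u ^ Y₂ + T       ≡⟨ cong (_+ T) (signed-power-^ s b Y₁ Y₂) ⟩
  s₂ * W + T       ≡⟨ cong (_+ T) insert-sign-square ⟩
  σ * (s₁ * W) + T ≈⟨ +-cong-mod (*-cong-mod (≡-mod-refl σ) (≡-mod-sym second-power)) (≡-mod-refl T) ⟩
  σ * a ^ (X₂ ℕ.* Y₁) + T ∎
  where
  open ≡-mod-Reasoning N
  Y₂ = suc y₂
  s = - λ′
  u = s * b ^ Y₁
  s₁ = s ^ Y₁
  s₂ = s ^ Y₂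
  σ = s₁ * s₂
  W = b ^ (Y₁ ℕ.* Y₂)
  T = h * (u ^ y₂ * + Y₂)
  regroup : ∀ s₁ s₂ W → s₁ * s₂ * (s₁ * W) ≡ s₁ * s₁ * (s₂ * W)
  regroup = solve-∀
  insert-sign-square : s₂ * W ≡ σ * (s₁ * W)
  insert-sign-square = sym (trans (regroup s₁ s₂ W)
    (trans (cong (_* (s₂ * W)) (sign-sq (sign-^ Y₁ (sign-neg λ±)))) (ℤP.*-identityˡ (s₂ * W))))
  second-power : a ^ (X₂ ℕ.* Y₁) ≡ s₁ * W mod N
  second-power = begin
    a ^ (X₂ ℕ.* Y₁)        ≡⟨ sym (ℤP.^-*-assoc a X₂ Y₁) ⟩
    (a ^ X₂) ^ Y₁          ≡⟨ cong (_^ Y₁) (trans (solution-shift (a ^ X₂) λ′ (b ^ Y₂) eq₂) (ℤP.+-comm H (s * b ^ Y₂))) ⟩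
    (s * b ^ Y₂ + H) ^ Y₁  ≈⟨ ^-cong-mod Y₁ (≡-mod-weaken N∣H (+-multiple-mod (s * b ^ Y₂) ∣-refl)) ⟩
    (s * b ^ Y₂) ^ Y₁      ≡⟨ signed-power-^ s b Y₂ Y₁ ⟩
    s₁ * b ^ (Y₂ ℕ.* Y₁)   ≡⟨ cong (λ e → s₁ * b ^ e) (ℕP.*-comm Y₂ Y₁) ⟩
    s₁ * W                 ∎

-- If x^p ≡ σ·x^q lifts from h to h·d, then x^p ≡ σ·x^q + h·t (mod h·d)
-- forces d ∣ t: modulo h the term h·t vanishes, so after lifting
-- h·d divides the difference h·t of the two congruences.
correction-divisible : ∀ {x h d σ t} p q → .{{_ : ℤ.NonZero h}} →
  (x ^ p ≡ σ * x ^ q mod h → x ^ p ≡ σ * x ^ q mod h * d) →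
  x ^ p ≡ σ * x ^ q + h * t mod h * d → d ∣ t
correction-divisible {x} {h} {d} {σ} {t} p q lift key =
  *-cancelˡ-∣ h (subst (h * d ∣_) (difference (x ^ p) (σ * x ^ q) (h * t))
    (∣m∣n⇒∣m-n (divides-difference (lift mod-h)) (divides-difference key)))
  where
  difference : ∀ X S T → (X - S) - (X - (S + T)) ≡ T
  difference = solve-∀
  mod-h : x ^ p ≡ σ * x ^ q mod h
  mod-h = ≡-mod-trans (≡-mod-weaken (∣m⇒∣m*n d ∣-refl) key) (+-multiple-mod (σ * x ^ q) (∣m⇒∣m*n t ∣-refl))

arrangement-facts : ∀ {a b c A B C λ′} → Coprime a b → Coprime b c → Coprime a c →
  IsTriple a b c A B C λ′ → Coprime C A × Coprime C B × IsSign λ′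
arrangement-facts a⊥b b⊥c a⊥c (inj₁ (refl , refl , refl , refl)) = Cop.sym a⊥c , Cop.sym b⊥c , inj₁ refl
arrangement-facts a⊥b b⊥c a⊥c (inj₂ (inj₁ (refl , refl , refl , refl))) = b⊥c , Cop.sym a⊥b , inj₂ refl
arrangement-facts a⊥b b⊥c a⊥c (inj₂ (inj₂ (refl , refl , refl , refl))) = a⊥c , a⊥b , inj₂ refl

-- Two coprime integers greater than 1 are not both 2, so any common upper bound exceeds 2.
coprime-pair-bound : ∀ {a b C} → 1 < a → 1 < b → Coprime a b → a ≤ C → b ≤ C → 2 < C
coprime-pair-bound {a} {b} {C} 1<a 1<b a⊥b a≤C b≤C with 2 ℕP.<? C
... | yes 2<C = 2<C
... | no  2≮C = ⊥-elim (two≢one (subst₂ Coprime a≡2 b≡2 a⊥b (ℕD.∣-refl , ℕD.∣-refl)))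
  where
  C≤2 : C ≤ 2
  C≤2 = ℕP.≮⇒≥ 2≮C
  a≡2 : a ≡ 2
  a≡2 = ℕP.≤-antisym (ℕP.≤-trans a≤C C≤2) 1<a
  b≡2 : b ≡ 2
  b≡2 = ℕP.≤-antisym (ℕP.≤-trans b≤C C≤2) 1<b
  two≢one : 2 ≢ 1
  two≢one ()

∣-^ : ∀ x {k} → 1 ≤ k → x ∣ x ^ k
∣-^ x {suc k} _ = ∣m⇒∣m*n (x ^ k) ∣-refl

-- With
-- h = C^{Z₁}, d = gcd(C, f) and N = h·d, the congruence from the two solutions
-- has correction term h·w·Y₂ with w coprime to d, and twisted congruences
-- between powers of A lift from h to N.
gcd-divides-Y₂ : ∀ {A B C λ′} → Coprime C A → Coprime C B → IsSign λ′ → 2 < C →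
  ∀ {X₁ Y₁ Z₁ n₁ δ₁ f X₂ y₂ Z₂} → 1 ≤ Z₁ → (+ A) ^ X₁ + λ′ * (+ B) ^ Y₁ ≡ (+ C) ^ Z₁ →
  1 ≤ n₁ → (∀ n → PlusMinusOneOrder A C Z₁ n → n₁ ≤ n) → IsSign δ₁ →
  (+ A) ^ n₁ ≡ (+ C) ^ Z₁ * + f + δ₁ →
  (+ A) ^ X₂ + λ′ * (+ B) ^ suc y₂ ≡ (+ C) ^ Z₂ → Z₁ < Z₂ →
  gcd C f ℕD.∣ suc y₂
gcd-divides-Y₂ {A} {B} {C} {λ′} C⊥A C⊥B λ± C>2 {X₁} {Y₁} {Z₁} {n₁} {δ₁} {f} {X₂} {y₂} {Z₂}
               Z₁≥1 eq₁ n₁≥1 n₁-minimal δ₁± f-def eq₂ Z₁<Z₂ =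
  coprime-divisor d⊥w (subst (d ℕD.∣_) (ℤP.abs-* w (+ suc y₂)) (∣⇒∣ᵤ d∣correction))
  where
  h = (+ C) ^ Z₁
  d = gcd C f
  N = h * + d
  s = - λ′
  σ = s ^ Y₁ * s ^ suc y₂
  w = (s * (+ B) ^ Y₁) ^ y₂
  instance
    _ : ℕ.NonZero C
    _ = ℕ.>-nonZero (ℕP.<-trans (s≤s z≤n) C>2)
    h≢0 : ℤ.NonZero h
    h≢0 = subst ℕ.NonZero (sym (abs-^ (+ C) Z₁)) (ℕP.m^n≢0 C Z₁)
  h>2 : 2 < ∣ h ∣
  h>2 = ℕP.<-≤-trans C>2 (ℕD.∣⇒≤ (∣⇒∣ᵤ (∣-^ (+ C) Z₁≥1)))
  h∣N : h ∣ N
  h∣N = ∣m⇒∣m*n (+ d) ∣-refl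
  d∣C : + d ∣ + C
  d∣C = ∣ᵤ⇒∣ (gcd[m,n]∣m C f)
  N∣h² : N ∣ h * h
  N∣h² = *-monoʳ-∣ h (∣-trans d∣C (∣-^ (+ C) Z₁≥1))
  N∣H : N ∣ (+ C) ^ Z₂
  N∣H = subst (N ∣_) split (*-monoʳ-∣ h (∣-trans d∣C (∣-^ (+ C) (ℕP.m<n⇒0<n∸m Z₁<Z₂))))
    where
    split : h * (+ C) ^ (Z₂ ∸ Z₁) ≡ (+ C) ^ Z₂
    split = trans (sym (ℤP.^-distribˡ-+-* (+ C) Z₁ (Z₂ ∸ Z₁))) (cong ((+ C) ^_) (ℕP.m+[n∸m]≡n (ℕP.<⇒≤ Z₁<Z₂)))
  Aⁿ¹≡δ₁ : (+ A) ^ n₁ ≡ δ₁ mod N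
  Aⁿ¹≡δ₁ = congruent (subst (N ∣_) (sym (trans (cong (_- δ₁) f-def) (cancel (h * + f) δ₁)))
             (*-monoʳ-∣ h (∣ᵤ⇒∣ (gcd[m,n]∣n C f))))
    where
    cancel : ∀ F δ → (F + δ) - δ ≡ F
    cancel = solve-∀
  h⊥A : Coprime ∣ h ∣ A
  h⊥A = subst (λ n → Coprime n A) (sym (abs-^ (+ C) Z₁)) (Cop.sym (coprime-^ Z₁ (Cop.sym C⊥A)))
  d⊥w : Coprime d ∣ w ∣
  d⊥w = coprime-divisorˡ (gcd[m,n]∣m C f) (subst (Coprime C) (sym ∣w∣) (coprime-^ y₂ (coprime-^ Y₁ C⊥B)))
    where
    ∣w∣ : ∣ w ∣ ≡ (B ℕ.^ Y₁) ℕ.^ y₂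
    ∣w∣ = trans (abs-^ _ y₂) (cong (ℕ._^ y₂) (trans (abs-sign-* (sign-neg λ±) _) (abs-^ (+ B) Y₁)))
  σ± : IsSign σ
  σ± = sign-* (sign-^ Y₁ (sign-neg λ±)) (sign-^ (suc y₂) (sign-neg λ±))
  lift : ∀ p q → (+ A) ^ p ≡ σ * (+ A) ^ q mod h → (+ A) ^ p ≡ σ * (+ A) ^ q mod N
  lift = lift-twisted h⊥A σ± (lift-sign-power {C = C} {Z = Z₁} n₁≥1 n₁-minimal δ₁± σ± h>2 h∣N Aⁿ¹≡δ₁)
  d∣correction : + d ∣ w * + suc y₂
  d∣correction = correction-divisible {σ = σ} (X₁ ℕ.* suc y₂) (X₂ ℕ.* Y₁) (lift (X₁ ℕ.* suc y₂) (X₂ ℕ.* Y₁))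
                   (two-solutions-congruence X₁ Y₁ X₂ y₂ λ± eq₁ eq₂ N∣h² N∣H)

-- Lemma 3.7.
lemma3p7 : (a b c : ℕ) → 1 < a → 1 < b → 1 < c →
    Coprime a b → Coprime b c → Coprime a c →
    (A B C : ℕ) (λ′ : ℤ) → IsTriple a b c A B C λ′ → C ≡ a ⊔ (b ⊔ c) →
    (X₁ Y₁ Z₁ : ℕ) → Solution A B C λ′ X₁ Y₁ Z₁ →
    (∀ X Y Z → Solution A B C λ′ X Y Z → Z₁ ≤ Z) →
    (n₁ : ℕ) → PlusMinusOneOrder A C Z₁ n₁ →
    (∀ n → PlusMinusOneOrder A C Z₁ n → n₁ ≤ n) →
    (δ₁ : ℤ) → IsSign δ₁ → CongMod A C Z₁ n₁ δ₁ →
    (f : ℕ) → 1 ≤ f → (+ A) ℤ.^ n₁ ≡ (+ C) ℤ.^ Z₁ ℤ.* (+ f) ℤ.+ δ₁ →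
    (X₂ Y₂ Z₂ : ℕ) → Solution A B C λ′ X₂ Y₂ Z₂ → Z₁ < Z₂ →
    gcd C f ≤ Y₂
lemma3p7 a b c 1<a 1<b _ a⊥b b⊥c a⊥c A B C λ′ arrangement C-max X₁ Y₁ Z₁ (_ , _ , Z₁≥1 , eq₁) _
         n₁ (n₁≥1 , _) n₁-minimal δ₁ δ₁± _ f _ f-def X₂ .(suc y₂) Z₂ (_ , s≤s {n = y₂} z≤n , _ , eq₂) Z₁<Z₂
  with arrangement-facts a⊥b b⊥c a⊥c arrangement
... | C⊥A , C⊥B , λ± =
  ℕD.∣⇒≤ (gcd-divides-Y₂ C⊥A C⊥B λ± C>2 {X₁} {Y₁} {Z₁} {X₂ = X₂} Z₁≥1 eq₁ n₁≥1 n₁-minimal δ₁± f-def eq₂ Z₁<Z₂)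
  where
  C>2 : 2 < C
  C>2 = coprime-pair-bound 1<a 1<b a⊥b
          (subst (a ≤_) (sym C-max) (ℕP.m≤m⊔n a (b ⊔ c)))
          (subst (b ≤_) (sym C-max) (ℕP.≤-trans (ℕP.m≤m⊔n b c) (ℕP.m≤n⊔m a (b ⊔ c))))
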